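{- Let $G_0,G_1\in\mathbb{Z}$ and $(G_n)_{n\ge0}$ satisfy $G_n=G_{n-1}+G_{n-2}$ for $n\ge2$. If $k$ is an odd positive integer and $\pi_{G_0,G_1}(m)$ is even for all integers $m>2$, then $\mathcal{G}_{G_0,G_1}(k)\le2$.
   Context: $\mathcal{G}_{G_0,G_1}(k)$ is the greatest common divisor of all integers $\sum_{i=0}^{k-1}G_{n+i}$, $n\ge1$. For $m\ge2$, $\pi_{G_0,G_1}(m)$ is the smallest positive integer $r$ with $G_r\equiv G_0$ and $G_{r+1}\equiv G_1\pmod m$. -}

module Defs where

open import Data.Nat as ℕ using (ℕ; zero; suc; _<_; _≤_)
open import Data.Nat.Divisibility as ℕD using ()
open import Data.Integer as ℤ using (ℤ; +_)
open import Data.Integer.Divisibility as ℤD using ()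
open import Data.Product using (_×_)
open import Data.Empty using (⊥)

G : ℤ → ℤ → ℕ → ℤ
G G₀ G₁ zero = G₀
G G₀ G₁ (suc zero) = G₁
G G₀ G₁ (suc (suc n)) = G G₀ G₁ n ℤ.+ G G₀ G₁ (suc n)

blockSum : ℤ → ℤ → ℕ → ℕ → ℤ
blockSum G₀ G₁ zero n = + 0
blockSum G₀ G₁ (suc k) n = G G₀ G₁ n ℤ.+ blockSum G₀ G₁ k (suc n)

_≡_[mod_] : ℤ → ℤ → ℕ → Set
a ≡ b [mod m ] = (+ m) ℤD.∣ (a ℤ.- b)

-- g is the (nonnegative) greatest common divisor of all blockSum k n, n ≥ 1,
-- i.e. 𝒢_{G₀,G₁}(k) = g.
IsGcdOfSums : ℤ → ℤ → ℕ → ℕ → Set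
IsGcdOfSums G₀ G₁ k g =
  (∀ n → 1 ≤ n → (+ g) ℤD.∣ blockSum G₀ G₁ k n) ×
  (∀ (d : ℕ) → (∀ n → 1 ≤ n → (+ d) ℤD.∣ blockSum G₀ G₁ k n) → d ℕD.∣ g)

-- r = π_{G₀,G₁}(m): smallest positive r with G_r ≡ G₀, G_{r+1} ≡ G₁ (mod m)
IsPisano : ℤ → ℤ → ℕ → ℕ → Set
IsPisano G₀ G₁ m r =
  1 ≤ r × (G G₀ G₁ r ≡ G₀ [mod m ]) × (G G₀ G₁ (suc r) ≡ G₁ [mod m ]) ×
  (∀ s → 1 ≤ s → s < r → (G G₀ G₁ s ≡ G₀ [mod m ]) → (G G₀ G₁ (suc s) ≡ G₁ [mod m ]) → ⊥)

-- If g > 2 divided every block sum of k consecutive terms, the telescoping identity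
-- Σ_{i<k} G_{n+i} = G_{n+k+1} - G_{n+1} would make k a period of (G_n) mod g.
-- The least period π(g) divides every period, so the even number π(g) would divide
-- the odd number k.
module Submission where

open import Defs
open import Data.Nat using (ℕ; _≤_; _<_)
open import Data.Nat.Divisibility using (_∣_)
open import Data.Integer using (ℤ)
open import Relation.Nullary using (¬_)

open import Data.Nat as ℕ using (zero; suc; s≤s; z≤n; >-nonZero)
import Data.Nat.Properties as ℕP
open import Data.Nat.DivMod using (_%_; _/_; m≡m%n+[m/n]*n; m%n<n)
open import Data.Nat.Divisibility using (_∣?_; ∣-trans; m%n≡0⇒n∣m)
open import Data.Nat.Induction using (<-rec)
open import Data.Integer as ℤ using (+_; _-_; ∣_∣)
import Data.Integer.Properties as ℤP
import Data.Integer.Divisibility as ℤU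
import Data.Integer.Divisibility.Signed as ℤS
open import Data.Integer.Tactic.RingSolver using (solve-∀)
open import Data.Product using (∃; _×_; _,_; proj₁; proj₂)
open import Relation.Nullary using (Dec; yes; no; contradiction)
open import Relation.Nullary.Decidable using (_×-dec_; map′)
open import Relation.Unary using (Pred; Decidable)
open import Relation.Binary.PropositionalEquality
open ≡-Reasoning

module _ {p} {P : Pred ℕ p} (P? : Decidable P) where

  least-witness : ∀ {n} → P n → ∃ λ r → P r × (∀ {s} → s < r → ¬ P s)
  least-witness {n} = <-rec Goal step n
    where
    Goal : ℕ → Set p
    Goal n = P n → ∃ λ r → P r × (∀ {s} → s < r → ¬ P s)

    step : ∀ n → (∀ {m} → m < n → Goal m) → Goal n
    step n smaller pn with ℕP.anyUpTo? P? n
    ... | yes (m , m<n , pm) = smaller m<n pm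
    ... | no none            = n , pn , λ s<n ps → none (_ , s<n , ps)

module _ {m : ℕ} where

  private
    fromSigned : ∀ a b → (+ m) ℤS.∣ (a - b) → a ≡ b [mod m ]
    fromSigned a b = ℤS.∣⇒∣ᵤ

    toSigned : ∀ a b → a ≡ b [mod m ] → (+ m) ℤS.∣ (a - b)
    toSigned a b = ℤS.∣ᵤ⇒∣

  ≡mod-refl : ∀ a → a ≡ a [mod m ]
  ≡mod-refl a =
    fromSigned a a (subst ((+ m) ℤS.∣_) (sym (ℤP.+-inverseʳ a)) (ℤS.divides (+ 0) refl))

  ≡mod-sym : ∀ a b → a ≡ b [mod m ] → b ≡ a [mod m ]
  ≡mod-sym a b = subst (m ∣_) (ℤP.∣i-j∣≡∣j-i∣ a b)

  ≡mod-trans : ∀ a b c → a ≡ b [mod m ] → b ≡ c [mod m ] → a ≡ c [mod m ]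
  ≡mod-trans a b c a≡b b≡c =
    fromSigned a c (subst ((+ m) ℤS.∣_) (sym (split a b c))
      (ℤS.∣m∣n⇒∣m+n (toSigned a b a≡b) (toSigned b c b≡c)))
    where
    split : ∀ a b c → a - c ≡ (a - b) ℤ.+ (b - c)
    split = solve-∀

  ≡mod-+ : ∀ a b c d →
    a ≡ b [mod m ] → c ≡ d [mod m ] → (a ℤ.+ c) ≡ (b ℤ.+ d) [mod m ]
  ≡mod-+ a b c d a≡b c≡d =
    fromSigned (a ℤ.+ c) (b ℤ.+ d) (subst ((+ m) ℤS.∣_) (sym (regroup a b c d))
      (ℤS.∣m∣n⇒∣m+n (toSigned a b a≡b) (toSigned c d c≡d)))
    where
    regroup : ∀ a b c d → (a ℤ.+ c) - (b ℤ.+ d) ≡ (a - b) ℤ.+ (c - d)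
    regroup = solve-∀

  ≡mod-+-cancelʳ : ∀ a b c d →
    (a ℤ.+ c) ≡ (b ℤ.+ d) [mod m ] → c ≡ d [mod m ] → a ≡ b [mod m ]
  ≡mod-+-cancelʳ a b c d sum≡ c≡d =
    fromSigned a b (subst ((+ m) ℤS.∣_) (sym (regroup a b c d))
      (ℤS.∣m∣n⇒∣m-n (toSigned (a ℤ.+ c) (b ℤ.+ d) sum≡) (toSigned c d c≡d)))
    where
    regroup : ∀ a b c d → a - b ≡ ((a ℤ.+ c) - (b ℤ.+ d)) - (c - d)
    regroup = solve-∀

  ≡mod-dec : ∀ a b → Dec (a ≡ b [mod m ])
  ≡mod-dec a b = m ∣? ∣ a - b ∣

blockSum-telescope : ∀ G₀ G₁ k n →
  blockSum G₀ G₁ k n ℤ.+ G G₀ G₁ (suc n) ≡ G G₀ G₁ (suc n ℕ.+ k)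
blockSum-telescope G₀ G₁ zero n = begin
  + 0 ℤ.+ G G₀ G₁ (suc n)  ≡⟨ ℤP.+-identityˡ _ ⟩
  G G₀ G₁ (suc n)          ≡⟨ cong (G G₀ G₁) (ℕP.+-identityʳ (suc n)) ⟨
  G G₀ G₁ (suc n ℕ.+ 0)    ∎
blockSum-telescope G₀ G₁ (suc k) n = begin
  (G G₀ G₁ n ℤ.+ blockSum G₀ G₁ k (suc n)) ℤ.+ G G₀ G₁ (suc n)
    ≡⟨ shuffle (G G₀ G₁ n) (blockSum G₀ G₁ k (suc n)) (G G₀ G₁ (suc n)) ⟩
  blockSum G₀ G₁ k (suc n) ℤ.+ G G₀ G₁ (suc (suc n))
    ≡⟨ blockSum-telescope G₀ G₁ k (suc n) ⟩
  G G₀ G₁ (suc (suc n) ℕ.+ k)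
    ≡⟨ cong (G G₀ G₁) (cong suc (ℕP.+-suc n k)) ⟨
  G G₀ G₁ (suc n ℕ.+ suc k)
    ∎
  where
  shuffle : ∀ x y z → (x ℤ.+ y) ℤ.+ z ≡ y ℤ.+ (x ℤ.+ z)
  shuffle = solve-∀

module Periodicity (G₀ G₁ : ℤ) (m : ℕ) where

  private
    Gₙ : ℕ → ℤ
    Gₙ = G G₀ G₁

  -- A record rather than a product, so that p can be inferred from a proof.
  record IsPeriod (p : ℕ) : Set where
    constructor returns
    field
      returns₀ : Gₙ p ≡ G₀ [mod m ]
      returns₁ : Gₙ (suc p) ≡ G₁ [mod m ]

  period-shift : ∀ {p} → IsPeriod p → ∀ n → Gₙ (n ℕ.+ p) ≡ Gₙ n [mod m ]
  period-shift {p} (returns p₀ p₁) n = proj₁ (consecutive n)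
    where
    consecutive : ∀ n →
      Gₙ (n ℕ.+ p) ≡ Gₙ n [mod m ] × Gₙ (suc n ℕ.+ p) ≡ Gₙ (suc n) [mod m ]
    consecutive zero    = p₀ , p₁
    consecutive (suc n) with consecutive n
    ... | now , next =
      next , ≡mod-+ (Gₙ (n ℕ.+ p)) (Gₙ n) (Gₙ (suc n ℕ.+ p)) (Gₙ (suc n)) now next

  period-zero : IsPeriod 0
  period-zero = returns (≡mod-refl G₀) (≡mod-refl G₁)

  period-+ : ∀ {a b} → IsPeriod a → IsPeriod b → IsPeriod (a ℕ.+ b)
  period-+ {a} {b} (returns a₀ a₁) per-b = returns
    (≡mod-trans (Gₙ (a ℕ.+ b)) (Gₙ a) G₀ (period-shift per-b a) a₀)
    (≡mod-trans (Gₙ (suc a ℕ.+ b)) (Gₙ (suc a)) G₁ (period-shift per-b (suc a)) a₁)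

  period-* : ∀ {p} → IsPeriod p → ∀ q → IsPeriod (q ℕ.* p)
  period-* per zero    = period-zero
  period-* per (suc q) = period-+ per (period-* per q)

  period-∸ : ∀ {b c} → IsPeriod b → IsPeriod (c ℕ.+ b) → IsPeriod c
  period-∸ {b} {c} per-b (returns cb₀ cb₁) = returns
    (≡mod-trans (Gₙ c) (Gₙ (c ℕ.+ b)) G₀
      (≡mod-sym (Gₙ (c ℕ.+ b)) (Gₙ c) (period-shift per-b c)) cb₀)
    (≡mod-trans (Gₙ (suc c)) (Gₙ (suc c ℕ.+ b)) G₁
      (≡mod-sym (Gₙ (suc c ℕ.+ b)) (Gₙ (suc c)) (period-shift per-b (suc c))) cb₁)

  isPeriod? : ∀ p → Dec (IsPeriod p)
  isPeriod? p = map′ (λ (p₀ , p₁) → returns p₀ p₁) (λ (returns p₀ p₁) → p₀ , p₁)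
    (≡mod-dec (Gₙ p) G₀ ×-dec ≡mod-dec (Gₙ (suc p)) G₁)

  pisano-exists : ∀ {p} → 1 ≤ p → IsPeriod p → ∃ (IsPisano G₀ G₁ m)
  pisano-exists 1≤p per with least-witness (λ s → 1 ℕP.≤? s ×-dec isPeriod? s) (1≤p , per)
  ... | r , (1≤r , returns r₀ r₁) , minimal =
    r , 1≤r , r₀ , r₁ , λ s 1≤s s<r s₀ s₁ → minimal s<r (1≤s , returns s₀ s₁)

  pisano-minimal : ∀ {r s} → IsPisano G₀ G₁ m r → IsPeriod s → s < r → s ≡ 0
  pisano-minimal {s = zero}  _                   _               _   = refl
  pisano-minimal {s = suc s} (_ , _ , _ , fewer) (returns s₀ s₁) s<r =
    contradiction (fewer (suc s) (s≤s z≤n) s<r s₀ s₁) λ ()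

  pisano-∣ : ∀ {r p} → IsPisano G₀ G₁ m r → IsPeriod p → r ∣ p
  pisano-∣ {r} {p} pisano@(1≤r , r₀ , r₁ , _) per =
    m%n≡0⇒n∣m p r (pisano-minimal pisano remainder-period (m%n<n p r))
    where
    instance
      r≢0 : ℕ.NonZero r
      r≢0 = >-nonZero 1≤r

    remainder-period : IsPeriod (p % r)
    remainder-period =
      period-∸ (period-* (returns r₀ r₁) (p / r)) (subst IsPeriod (m≡m%n+[m/n]*n p r) per)

  sums-divisible⇒period : ∀ {k} →
    (∀ n → 1 ≤ n → (+ m) ℤU.∣ blockSum G₀ G₁ k n) → IsPeriod k
  sums-divisible⇒period {k} m∣sums =
    returns (shift-pred 0 shift-1 (shift-2+ 0)) shift-1
    where
    shift-2+ : ∀ n → Gₙ (suc (suc n) ℕ.+ k) ≡ Gₙ (suc (suc n)) [mod m ]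
    shift-2+ n = subst ((+ m) ℤU.∣_) difference (m∣sums (suc n) (s≤s z≤n))
      where
      cancel : ∀ s y → s ≡ (s ℤ.+ y) - y
      cancel = solve-∀

      difference : blockSum G₀ G₁ k (suc n) ≡ Gₙ (suc (suc n) ℕ.+ k) - Gₙ (suc (suc n))
      difference = trans (cancel _ _)
        (cong (_- Gₙ (suc (suc n))) (blockSum-telescope G₀ G₁ k (suc n)))

    -- Both sides of the second congruence unfold by the recurrence, G_{j+2} = G_j + G_{j+1}.
    shift-pred : ∀ j → Gₙ (suc j ℕ.+ k) ≡ Gₙ (suc j) [mod m ] →
      Gₙ (suc (suc j) ℕ.+ k) ≡ Gₙ (suc (suc j)) [mod m ] → Gₙ (j ℕ.+ k) ≡ Gₙ j [mod m ]
    shift-pred j next next² =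
      ≡mod-+-cancelʳ (Gₙ (j ℕ.+ k)) (Gₙ j) (Gₙ (suc j ℕ.+ k)) (Gₙ (suc j)) next² next

    shift-1 : Gₙ (suc k) ≡ G₁ [mod m ]
    shift-1 = shift-pred 1 (shift-2+ 0) (shift-2+ 1)

lemma5p4 : (G₀ G₁ : ℤ) (k : ℕ) →
    1 ≤ k → ¬ (2 ∣ k) →
    (∀ (m r : ℕ) → 2 < m → IsPisano G₀ G₁ m r → 2 ∣ r) →
    ∀ (g : ℕ) → IsGcdOfSums G₀ G₁ k g → g ≤ 2
lemma5p4 G₀ G₁ k 1≤k k-odd π-even g (g∣sums , _) with g ℕP.≤? 2
... | yes g≤2 = g≤2
... | no g≰2 = contradiction (∣-trans 2∣r r∣k) k-odd
  where
  open Periodicity G₀ G₁ g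
  k-period : IsPeriod k
  k-period = sums-divisible⇒period g∣sums

  r : ℕ
  r = proj₁ (pisano-exists 1≤k k-period)

  pisano : IsPisano G₀ G₁ g r
  pisano = proj₂ (pisano-exists 1≤k k-period)

  2∣r : 2 ∣ r
  2∣r = π-even g r (ℕP.≰⇒> g≰2) pisano

  r∣k : r ∣ k
  r∣k = pisano-∣ pisano k-period
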